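{- For $n\ge 6$, $1\le k\le\lfloor n/2\rfloor-1$, and every real $r>1$, \[r\cdot P^{n,k+1}(r)-P^{n,k}(r)>0.\]
   Context: For an integer $n\ge 2$ let $N=\binom{n}{2}$. The edges $(i,j)$, $1\le i<j\le n$, of $K_n$ are ordered lexicographically $(1,2),(1,3),\dots,(1,n),(2,3),\dots,(n-1,n)$; $(i,j)$ has index $\mathrm{idx}(i,j)=(i-1)n-\binom{i}{2}+(j-i)$. For a binary string $\mathbf{x}=(x_1,\dots,x_n)$, the cut vector $\delta(\mathbf{x})\in\{0,1\}^N$ has entry $1$ at position $\mathrm{idx}(i,j)$ iff $x_i\ne x_j$. For $\delta\in\{0,1\}^N$ and real $r$, $W^n(\delta;r)=\sum_{i=1}^N\delta_i r^{N-i}$. For $1\le k\le n$, $C_k=\delta(1^k0^{n-k})$ ($k$ ones followed by $n-k$ zeros). For $1\le k\le n-1$, $P^{n,k}(r)=W^n(C_k;r)-W^n(C_{k+1};r)$. -}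

module Defs where

open import Level using (Level; _⊔_) renaming (suc to lsuc)
open import Algebra.Bundles using (CommutativeRing)
open import Relation.Binary.Core using (Rel)
open import Relation.Binary.Structures using (IsStrictTotalOrder)
open import Relation.Nullary using (¬_)
open import Relation.Unary using (Pred)
open import Data.Product using (_×_; _,_; ∃)
open import Data.Sum using (_⊎_)
open import Data.Bool using (Bool; true; false; _xor_)
open import Data.Nat as ℕ using (ℕ; zero; suc)
open import Data.Fin using (Fin; toℕ)
open import Data.Fin.Properties using (_<?_)
open import Data.Vec using (Vec; lookup; tabulate)
open import Data.List using (List; []; _∷_; map; concatMap; filter; length; allFin)

-- The real numbers, axiomatised as a Dedekind-complete ordered field.
-- (Every such structure is isomorphic to ℝ; the stdlib has no reals.)

record CompleteOrderedField (c ℓ₁ ℓ₂ : Level) : Set (lsuc (c ⊔ ℓ₁ ⊔ ℓ₂)) where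
  field
    commutativeRing : CommutativeRing c ℓ₁
  open CommutativeRing commutativeRing public
  infix 4 _<_ _≤_
  field
    _<_                : Rel Carrier ℓ₂
    isStrictTotalOrder : IsStrictTotalOrder _≈_ _<_
    0≉1     : ¬ (0# ≈ 1#)
    inverse : ∀ x → ¬ (x ≈ 0#) → ∃ λ y → x * y ≈ 1#
    +-monoʳ-< : ∀ z {x y} → x < y → x + z < y + z
    *-pos     : ∀ {x y} → 0# < x → 0# < y → 0# < x * y

  _≤_ : Rel Carrier (ℓ₁ ⊔ ℓ₂)
  x ≤ y = x < y ⊎ x ≈ y

  IsUpperBound : Pred Carrier c → Carrier → Set (c ⊔ ℓ₁ ⊔ ℓ₂)
  IsUpperBound S b = ∀ x → S x → x ≤ b

  field
    complete : (S : Pred Carrier c) → ∃ S → ∃ (IsUpperBound S) →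
               ∃ λ s → IsUpperBound S s × (∀ b → IsUpperBound S b → s ≤ b)

-- Vertices 1..n are represented by Fin n (vertex i ↦ Fin element i-1);
-- allFin n is increasing, so the list below is (1,2),(1,3),…,(n-1,n),
-- i.e. the edge at list position idx(i,j) is (i,j).

edges : (n : ℕ) → List (Fin n × Fin n)
edges n = concatMap (λ i → map (i ,_) (filter (λ j → toℕ i ℕ.<? toℕ j) (allFin n)))
                    (allFin n)

BinStr : ℕ → Set
BinStr n = Vec Bool n

cutVec : ∀ {n} → BinStr n → List Bool
cutVec {n} x = map (λ e → lookup x (Data.Product.proj₁ e) xor lookup x (Data.Product.proj₂ e)) (edges n)

-- C_k = δ(1^k 0^(n-k)) : position i (1-based) is 1 iff i ≤ k
onesThenZeros : (n k : ℕ) → BinStr n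
onesThenZeros n k = tabulate (λ i → toℕ i ℕ.<ᵇ k)

C : (n k : ℕ) → List Bool
C n k = cutVec (onesThenZeros n k)

-- W^n(δ; r) = Σ_{i=1}^N δ_i r^(N-i) and P^{n,k}(r), in a field R.

module _ {c ℓ₁ ℓ₂} (R : CompleteOrderedField c ℓ₁ ℓ₂) where
  open CompleteOrderedField R

  pow : Carrier → ℕ → Carrier
  pow r zero    = 1#
  pow r (suc m) = r * pow r m

  bit : Bool → Carrier
  bit true  = 1#
  bit false = 0#

  -- for δ = δ_i ∷ rest, the remaining length of rest is N - i
  W : List Bool → Carrier → Carrier
  W []      r = 0#
  W (b ∷ δ) r = bit b * pow r (length δ) + W δ r

  P : (n k : ℕ) → Carrier → Carrier
  P n k r = W (C n k) r - W (C n (suc k)) r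

-- Write A(n,k) = W^n(C_k; r), so that P^{n,k} = A(n,k) - A(n,k+1) and the claim is equivalent to
-- r·A(n,k+2) + A(n,k) < r·A(n,k+1) + A(n,k+1).  Splitting off the edges at vertex 1, the cut vector
-- C_{k+1} on n+1 vertices is the row 0^k 1^(n-k) followed by C_k on n vertices, so
-- A(n+1,k+1) = W(0^k 1^(n-k); r)·r^N(n) + A(n,k).  Row weights are geometric sums, for which the two
-- sides of the inequality are equal; hence passing from (n,k) to (n+1,k+1) adds the same amount to
-- both sides, and the claim reduces to k = 0.  On q + 2 vertices, with G = 1 + r + ... + r^(q-1), it
-- then reads r·G < r^q·G + r^(2q+1) + r^(2q), true because r ≤ r^q when q ≥ 1 and G = 0 when q = 0.

module Submission where

open import Defs
open import Data.Nat as ℕ using (ℕ; suc; _/_; _∸_; _<ᵇ_)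
open import Data.Nat.Properties as ℕ using ()
open import Data.Nat.DivMod using (/-monoˡ-≤; m/n<m)
open import Data.Bool using (Bool; true; false; _xor_; not)
open import Data.Fin as Fin using (Fin; toℕ)
open import Data.Product as Product using (_×_; _,_; proj₁; proj₂)
open import Data.Sum using (inj₁; inj₂)
open import Data.Empty using (⊥-elim)
open import Data.List using (List; []; _∷_; map; concatMap; filter; length; allFin; tabulate; _++_)
open import Data.List.Properties
  using (filter-all; map-tabulate; map-∘; map-cong; map-++; concatMap-map; concatMap-cong; map-concatMap;
         length-++; length-map; length-tabulate)
open import Data.List.Relation.Unary.All.Properties using (tabulate⁺)
open import Data.Vec as Vec using (lookup)
open import Data.Vec.Properties using (lookup∘tabulate)
open import Function using (id; _∘_)
open import Level using (Level)
open import Relation.Nullary using (does)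
open import Relation.Unary using (Pred; Decidable)
open import Relation.Binary.Bundles using (StrictTotalOrder)
open import Relation.Binary.Definitions using (tri<; tri≈; tri>)
open import Relation.Binary.PropositionalEquality as ≡ using (_≡_)
import Relation.Binary.Construct.StrictToNonStrict as StrictToNonStrict
import Relation.Binary.Reasoning.StrictPartialOrder as StrictReasoning

private variable
  ℓᵃ ℓᵇ ℓᵖ ℓᵠ : Level
  A : Set ℓᵃ
  B : Set ℓᵇ

filter-map : ∀ {P : Pred B ℓᵖ} {Q : Pred A ℓᵠ} (P? : Decidable P) (Q? : Decidable Q) (f : A → B) →
             (∀ x → does (P? (f x)) ≡ does (Q? x)) →
             ∀ xs → filter P? (map f xs) ≡ map f (filter Q? xs)
filter-map P? Q? f agree []       = ≡.refl
filter-map P? Q? f agree (x ∷ xs) rewrite agree x with does (Q? x)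
... | true  = ≡.cong (f x ∷_) (filter-map P? Q? f agree xs)
... | false = filter-map P? Q? f agree xs

tabulate-suc : ∀ m → tabulate {n = m} Fin.suc ≡ map Fin.suc (allFin m)
tabulate-suc m = ≡.sym (map-tabulate id Fin.suc)

above : ∀ {n} → Fin n → List (Fin n)
above {n} i = filter (λ j → toℕ i ℕ.<? toℕ j) (allFin n)

above-zero : ∀ m → above (Fin.zero {m}) ≡ map Fin.suc (allFin m)
above-zero m = ≡.trans (filter-all (λ j → 0 ℕ.<? toℕ j) (tabulate⁺ (λ _ → ℕ.z<s))) (tabulate-suc m)

above-suc : ∀ {m} (i : Fin m) → above (Fin.suc i) ≡ map Fin.suc (above i)
above-suc {m} i = ≡.trans (≡.cong (filter _) (tabulate-suc m)) (filter-map _ _ Fin.suc (λ _ → ≡.refl) (allFin m))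

edges-suc : ∀ m → edges (suc m) ≡
            map (λ j → Fin.zero , Fin.suc j) (allFin m) ++ map (Product.map Fin.suc Fin.suc) (edges m)
edges-suc m = ≡.cong₂ _++_ first-row later-rows
  where
  row : ∀ {n} → Fin n → List (Fin n × Fin n)
  row i = map (i ,_) (above i)

  first-row : row Fin.zero ≡ map (λ j → Fin.zero , Fin.suc j) (allFin m)
  first-row = ≡.trans (≡.cong (map _) (above-zero m)) (≡.sym (map-∘ (allFin m)))

  row-suc : ∀ (i : Fin m) → row (Fin.suc i) ≡ map (Product.map Fin.suc Fin.suc) (row i)
  row-suc i = ≡.trans (≡.cong (map _) (above-suc i)) (≡.trans (≡.sym (map-∘ (above i))) (map-∘ (above i)))

  later-rows : concatMap row (tabulate Fin.suc) ≡ map (Product.map Fin.suc Fin.suc) (edges m)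
  later-rows = begin
    concatMap row (tabulate Fin.suc)          ≡⟨ ≡.cong (concatMap row) (tabulate-suc m) ⟩
    concatMap row (map Fin.suc (allFin m))    ≡⟨ concatMap-map row Fin.suc (allFin m) ⟩
    concatMap (row ∘ Fin.suc) (allFin m)      ≡⟨ concatMap-cong row-suc (allFin m) ⟩
    concatMap (map _ ∘ row) (allFin m)        ≡⟨ map-concatMap _ row (allFin m) ⟨
    map (Product.map Fin.suc Fin.suc) (edges m) ∎
    where open ≡.≡-Reasoning

length-edges-suc : ∀ m → length (edges (suc m)) ≡ m ℕ.+ length (edges m)
length-edges-suc m = begin
  length (edges (suc m))                              ≡⟨ ≡.cong length (edges-suc m) ⟩
  length (map _ (allFin m) ++ map _ (edges m))        ≡⟨ length-++ (map _ (allFin m)) ⟩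
  length (map _ (allFin m)) ℕ.+ length (map _ (edges m))
    ≡⟨ ≡.cong₂ ℕ._+_ (≡.trans (length-map _ (allFin m)) (length-tabulate id)) (length-map _ (edges m)) ⟩
  m ℕ.+ length (edges m)                              ∎
  where open ≡.≡-Reasoning

cutVec-∷ : ∀ {m} b (xs : BinStr m) →
           cutVec (b Vec.∷ xs) ≡ map (λ j → b xor lookup xs j) (allFin m) ++ cutVec xs
cutVec-∷ {m} b xs = ≡.trans (≡.cong (map _) (edges-suc m))
  (≡.trans (map-++ _ (map _ (allFin m)) (map _ (edges m)))
           (≡.cong₂ _++_ (≡.sym (map-∘ (allFin m))) (≡.sym (map-∘ (edges m)))))

zerosThenOnes : ℕ → ℕ → List Bool
zerosThenOnes m k = tabulate (λ (j : Fin m) → not (toℕ j <ᵇ k))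

C-suc : ∀ m k → C (suc m) (suc k) ≡ zerosThenOnes m k ++ C m k
C-suc m k = ≡.trans (cutVec-∷ true (onesThenZeros m k)) (≡.cong (_++ C m k) first-row)
  where
  first-row : map (λ j → not (lookup (onesThenZeros m k) j)) (allFin m) ≡ zerosThenOnes m k
  first-row = ≡.trans (map-cong (λ j → ≡.cong not (lookup∘tabulate _ j)) (allFin m)) (map-tabulate id _)

C-zero : ∀ m → C m 0 ≡ map (λ _ → false) (edges m)
C-zero m = map-cong (λ e → ≡.cong₂ _xor_ (lookup∘tabulate _ (proj₁ e)) (lookup∘tabulate _ (proj₂ e))) (edges m)

module OrderedFieldProperties {c ℓ₁ ℓ₂} (F : CompleteOrderedField c ℓ₁ ℓ₂) where
  open CompleteOrderedField F
  open import Algebra.Properties.Ring ring using (-1*x≈-x; x[y-z]≈xy-xz)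
  open import Algebra.Properties.Group +-group using (⁻¹-involutive; //-rightDividesˡ)
  open import Algebra.Properties.AbelianGroup +-abelianGroup using (⁻¹-anti-homo‿-; ⁻¹-∙-comm)
  open import Algebra.Properties.CommutativeSemigroup +-commutativeSemigroup using (interchange)

  strictTotalOrder : StrictTotalOrder c ℓ₁ ℓ₂
  strictTotalOrder = record { isStrictTotalOrder = isStrictTotalOrder }

  open StrictTotalOrder strictTotalOrder public using (strictPartialOrder; <-respˡ-≈; <-respʳ-≈)
  open StrictTotalOrder strictTotalOrder using (compare; asym) renaming (trans to <-trans)

  open StrictReasoning strictPartialOrder

  <-≤-trans : ∀ {x y z} → x < y → y ≤ z → x < z
  <-≤-trans = StrictToNonStrict.<-≤-trans _≈_ _<_ <-trans <-respʳ-≈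

  x<y⇒0<y-x : ∀ {x y} → x < y → 0# < y - x
  x<y⇒0<y-x {x} x<y = <-respˡ-≈ (-‿inverseʳ x) (+-monoʳ-< (- x) x<y)

  0<y-x⇒x<y : ∀ {x y} → 0# < y - x → x < y
  0<y-x⇒x<y {x} {y} 0<y-x = <-respʳ-≈ (//-rightDividesˡ x y) (<-respˡ-≈ (+-identityˡ x) (+-monoʳ-< x 0<y-x))

  +-monoˡ-< : ∀ z {x y} → x < y → z + x < z + y
  +-monoˡ-< z {x} {y} x<y = <-respʳ-≈ (+-comm y z) (<-respˡ-≈ (+-comm x z) (+-monoʳ-< z x<y))

  +-monoʳ-≤ : ∀ z {x y} → x ≤ y → x + z ≤ y + z
  +-monoʳ-≤ z (inj₁ x<y) = inj₁ (+-monoʳ-< z x<y)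
  +-monoʳ-≤ z (inj₂ x≈y) = inj₂ (+-congʳ x≈y)

  +-monoˡ-≤ : ∀ z {x y} → x ≤ y → z + x ≤ z + y
  +-monoˡ-≤ z (inj₁ x<y) = inj₁ (+-monoˡ-< z x<y)
  +-monoˡ-≤ z (inj₂ x≈y) = inj₂ (+-congˡ x≈y)

  0<1 : 0# < 1#
  0<1 with compare 0# 1#
  ... | tri< 0<1 _ _ = 0<1
  ... | tri≈ _ 0≈1 _ = ⊥-elim (0≉1 0≈1)
  ... | tri> _ _ 1<0 = ⊥-elim (asym 1<0 (<-respʳ-≈ -1*-1≈1 (*-pos 0<-1 0<-1)))
    where
    0<-1 : 0# < - 1#
    0<-1 = <-respʳ-≈ (+-identityˡ (- 1#)) (x<y⇒0<y-x 1<0)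
    -1*-1≈1 : - 1# * - 1# ≈ 1#
    -1*-1≈1 = trans (-1*x≈-x (- 1#)) (⁻¹-involutive 1#)

  nonNeg+nonNeg⇒nonNeg : ∀ {x y} → 0# ≤ x → 0# ≤ y → 0# ≤ x + y
  nonNeg+nonNeg⇒nonNeg {x} {y} 0≤x 0≤y = begin
    0#      ≈⟨ +-identityʳ 0# ⟨
    0# + 0# ≤⟨ +-monoʳ-≤ 0# 0≤x ⟩
    x + 0#  ≤⟨ +-monoˡ-≤ x 0≤y ⟩
    x + y   ∎

  pos+nonNeg⇒pos : ∀ {x y} → 0# < x → 0# ≤ y → 0# < x + y
  pos+nonNeg⇒pos {x} {y} 0<x 0≤y = begin-strict
    0#      ≈⟨ +-identityʳ 0# ⟨
    0# + 0# <⟨ +-monoʳ-< 0# 0<x ⟩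
    x + 0#  ≤⟨ +-monoˡ-≤ x 0≤y ⟩
    x + y   ∎

  nonNeg*nonNeg⇒nonNeg : ∀ {x y} → 0# ≤ x → 0# ≤ y → 0# ≤ x * y
  nonNeg*nonNeg⇒nonNeg         (inj₁ 0<x) (inj₁ 0<y) = inj₁ (*-pos 0<x 0<y)
  nonNeg*nonNeg⇒nonNeg {y = y} (inj₂ 0≈x) _          = inj₂ (trans (sym (zeroˡ y)) (*-congʳ 0≈x))
  nonNeg*nonNeg⇒nonNeg {x = x} (inj₁ _)   (inj₂ 0≈y) = inj₂ (trans (sym (zeroʳ x)) (*-congˡ 0≈y))

  *-monoˡ-≤-nonNeg : ∀ {z x y} → 0# ≤ z → x ≤ y → z * x ≤ z * y
  *-monoˡ-≤-nonNeg         _          (inj₂ x≈y) = inj₂ (*-congˡ x≈y)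
  *-monoˡ-≤-nonNeg {z} {x} {y} (inj₁ 0<z) (inj₁ x<y) =
    inj₁ (0<y-x⇒x<y (<-respʳ-≈ (x[y-z]≈xy-xz z y x) (*-pos 0<z (x<y⇒0<y-x x<y))))
  *-monoˡ-≤-nonNeg {z} {x} {y} (inj₂ 0≈z) (inj₁ _) = inj₂ (begin-equality
    z * x  ≈⟨ *-congʳ 0≈z ⟨
    0# * x ≈⟨ zeroˡ x ⟩
    0#     ≈⟨ zeroˡ y ⟨
    0# * y ≈⟨ *-congʳ 0≈z ⟩
    z * y  ∎)

  x≤y⇒x<z+y : ∀ {x y z} → x ≤ y → 0# < z → x < z + y
  x≤y⇒x<z+y {x} {y} {z} x≤y 0<z = begin-strict
    x      ≤⟨ x≤y ⟩
    y      ≈⟨ +-identityˡ y ⟨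
    0# + y <⟨ +-monoʳ-< y 0<z ⟩
    z + y  ∎

  r*z+x<r*y+y⇒0<r*[y-z]-[x-y] : ∀ r x y z → r * z + x < r * y + y → 0# < r * (y - z) - (x - y)
  r*z+x<r*y+y⇒0<r*[y-z]-[x-y] r x y z lt = <-respʳ-≈ (sym rearrange) (x<y⇒0<y-x lt)
    where
    rearrange : r * (y - z) - (x - y) ≈ (r * y + y) - (r * z + x)
    rearrange = begin-equality
      r * (y - z) - (x - y)           ≈⟨ +-cong (x[y-z]≈xy-xz r y z) (⁻¹-anti-homo‿- x y) ⟩
      (r * y - r * z) + (y - x)       ≈⟨ interchange (r * y) (- (r * z)) y (- x) ⟩
      (r * y + y) + (- (r * z) - x)   ≈⟨ +-congˡ (⁻¹-∙-comm (r * z) x) ⟩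
      (r * y + y) - (r * z + x)       ∎

module Weights {c ℓ₁ ℓ₂} (F : CompleteOrderedField c ℓ₁ ℓ₂) (r : CompleteOrderedField.Carrier F) where
  open CompleteOrderedField F
  open OrderedFieldProperties F
  open StrictReasoning strictPartialOrder
  open import Algebra.Solver.Ring.NaturalCoefficients.Default commutativeSemiring

  r^ : ℕ → Carrier
  r^ = pow F r

  w : List Bool → Carrier
  w δ = W F δ r

  r^-+ : ∀ m n → r^ (m ℕ.+ n) ≈ r^ m * r^ n
  r^-+ ℕ.zero    n = sym (*-identityˡ (r^ n))
  r^-+ (suc m) n = trans (*-congˡ (r^-+ m n)) (sym (*-assoc r (r^ m) (r^ n)))

  w-++ : ∀ xs ys → w (xs ++ ys) ≈ w xs * r^ (length ys) + w ys
  w-++ []       ys = sym (trans (+-congʳ (zeroˡ _)) (+-identityˡ _))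
  w-++ (b ∷ xs) ys = begin-equality
    bit F b * r^ (length (xs ++ ys)) + w (xs ++ ys)
      ≈⟨ +-cong (*-congˡ (trans (reflexive (≡.cong r^ (length-++ xs))) (r^-+ (length xs) (length ys)))) (w-++ xs ys) ⟩
    bit F b * (r^ (length xs) * r^ (length ys)) + (w xs * r^ (length ys) + w ys)
      ≈⟨ solve 5 (λ β p q u v → β :* (p :* q) :+ (u :* q :+ v) := (β :* p :+ u) :* q :+ v) refl
               (bit F b) (r^ (length xs)) (r^ (length ys)) (w xs) (w ys) ⟩
    (bit F b * r^ (length xs) + w xs) * r^ (length ys) + w ys ∎

  w-false-∷ : ∀ xs → w (false ∷ xs) ≈ w xs
  w-false-∷ xs = trans (+-congʳ (zeroˡ (r^ (length xs)))) (+-identityˡ (w xs))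

  w-all-false : ∀ (xs : List A) → w (map (λ _ → false) xs) ≈ 0#
  w-all-false []       = refl
  w-all-false (x ∷ xs) = trans (w-false-∷ (map _ xs)) (w-all-false xs)

  rowWeight : ℕ → ℕ → Carrier
  rowWeight m k = w (zerosThenOnes m k)

  rowWeight-suc : ∀ m k → k ℕ.< m → rowWeight m k ≈ r^ (m ∸ suc k) + rowWeight m (suc k)
  rowWeight-suc (suc m) ℕ.zero    _           = begin-equality
    w (true ∷ zerosThenOnes m 0)                         ≈⟨ +-congʳ (*-identityˡ _) ⟩
    r^ (length (zerosThenOnes m 0)) + rowWeight m 0
      ≈⟨ +-cong (reflexive (≡.cong r^ (length-tabulate {n = m} _))) (sym (w-false-∷ (zerosThenOnes m 0))) ⟩
    r^ m + w (false ∷ zerosThenOnes m 0)                 ∎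
  rowWeight-suc (suc m) (suc k) (ℕ.s≤s k<m) = begin-equality
    w (false ∷ zerosThenOnes m k)                        ≈⟨ w-false-∷ (zerosThenOnes m k) ⟩
    rowWeight m k                                        ≈⟨ rowWeight-suc m k k<m ⟩
    r^ (m ∸ suc k) + rowWeight m (suc k)                 ≈⟨ +-congˡ (w-false-∷ (zerosThenOnes m (suc k))) ⟨
    r^ (m ∸ suc k) + w (false ∷ zerosThenOnes m (suc k)) ∎

  weightC : ℕ → ℕ → Carrier
  weightC n k = w (C n k)

  r^N : ℕ → Carrier
  r^N m = r^ (length (edges m))

  r^N-suc : ∀ m → r^N (suc m) ≈ r^ m * r^N m
  r^N-suc m = trans (reflexive (≡.cong r^ (length-edges-suc m))) (r^-+ m (length (edges m)))

  weightC-suc : ∀ m k → weightC (suc m) (suc k) ≈ rowWeight m k * r^N m + weightC m k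
  weightC-suc m k = begin-equality
    w (C (suc m) (suc k))                                 ≈⟨ reflexive (≡.cong w (C-suc m k)) ⟩
    w (zerosThenOnes m k ++ C m k)                        ≈⟨ w-++ (zerosThenOnes m k) (C m k) ⟩
    rowWeight m k * r^ (length (C m k)) + weightC m k
      ≈⟨ +-congʳ (*-congˡ (reflexive (≡.cong r^ (length-map _ (edges m))))) ⟩
    rowWeight m k * r^N m + weightC m k                   ∎

  weightC-zero : ∀ m → weightC m 0 ≈ 0#
  weightC-zero m = trans (reflexive (≡.cong w (C-zero m))) (w-all-false (edges m))

  weightC-one : ∀ m → weightC (suc m) 1 ≈ rowWeight m 0 * r^N m
  weightC-one m = trans (weightC-suc m 0) (trans (+-congˡ (weightC-zero m)) (+-identityʳ _))

  Lower Upper : (ℕ → Carrier) → ℕ → Carrier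
  Lower f k = r * f (suc (suc k)) + f k
  Upper f k = r * f (suc k) + f (suc k)

  Gap : ℕ → ℕ → Set ℓ₂
  Gap n k = Lower (weightC n) k < Upper (weightC n) k

  Lower-weightC-suc : ∀ m k → Lower (weightC (suc m)) (suc k) ≈ Lower (rowWeight m) k * r^N m + Lower (weightC m) k
  Lower-weightC-suc m k =
    trans (+-cong (*-congˡ (weightC-suc m (suc (suc k)))) (weightC-suc m k))
          (solve 6 (λ ρ z₀ z₂ υ x₀ x₂ → ρ :* (z₂ :* υ :+ x₂) :+ (z₀ :* υ :+ x₀)
                                      := (ρ :* z₂ :+ z₀) :* υ :+ (ρ :* x₂ :+ x₀))
                 refl r (rowWeight m k) (rowWeight m (suc (suc k))) (r^N m) (weightC m k) (weightC m (suc (suc k))))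

  Upper-weightC-suc : ∀ m k → Upper (weightC (suc m)) (suc k) ≈ Upper (rowWeight m) k * r^N m + Upper (weightC m) k
  Upper-weightC-suc m k =
    trans (+-cong (*-congˡ (weightC-suc m (suc k))) (weightC-suc m (suc k)))
          (solve 4 (λ ρ z₁ υ x₁ → ρ :* (z₁ :* υ :+ x₁) :+ (z₁ :* υ :+ x₁) := (ρ :* z₁ :+ z₁) :* υ :+ (ρ :* x₁ :+ x₁))
                 refl r (rowWeight m (suc k)) (r^N m) (weightC m (suc k)))

  Lower≈Upper-rowWeight : ∀ m k → suc (suc k) ℕ.≤ m → Lower (rowWeight m) k ≈ Upper (rowWeight m) k
  Lower≈Upper-rowWeight m k 2+k≤m = begin-equality
    r * z₂ + z₀             ≈⟨ +-congˡ z₀≈ ⟩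
    r * z₂ + (r * a + z₁)   ≈⟨ solve 4 (λ ρ α ζ₁ ζ₂ → ρ :* ζ₂ :+ (ρ :* α :+ ζ₁) := ρ :* (α :+ ζ₂) :+ ζ₁) refl r a z₁ z₂ ⟩
    r * (a + z₂) + z₁       ≈⟨ +-congʳ (*-congˡ z₁≈) ⟨
    r * z₁ + z₁             ∎
    where
    a z₀ z₁ z₂ : Carrier
    a = r^ (m ∸ suc (suc k))
    z₀ = rowWeight m k
    z₁ = rowWeight m (suc k)
    z₂ = rowWeight m (suc (suc k))

    z₁≈ : z₁ ≈ a + z₂
    z₁≈ = rowWeight-suc m (suc k) 2+k≤m

    z₀≈ : z₀ ≈ r * a + z₁
    z₀≈ = trans (rowWeight-suc m k (ℕ.m+n≤o⇒n≤o 1 2+k≤m))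
                (+-congʳ (reflexive (≡.cong r^ (ℕ.+-∸-assoc 1 2+k≤m))))

  Gap-suc : ∀ m k → suc (suc k) ℕ.≤ m → Gap m k → Gap (suc m) (suc k)
  Gap-suc m k 2+k≤m gap = begin-strict
    Lower (weightC (suc m)) (suc k)                      ≈⟨ Lower-weightC-suc m k ⟩
    Lower (rowWeight m) k * r^N m + Lower (weightC m) k  ≈⟨ +-congʳ (*-congʳ (Lower≈Upper-rowWeight m k 2+k≤m)) ⟩
    Upper (rowWeight m) k * r^N m + Lower (weightC m) k  <⟨ +-monoˡ-< _ gap ⟩
    Upper (rowWeight m) k * r^N m + Upper (weightC m) k  ≈⟨ Upper-weightC-suc m k ⟨
    Upper (weightC (suc m)) (suc k)                      ∎

  module _ (1≤r : 1# ≤ r) where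

    0<r : 0# < r
    0<r = <-≤-trans 0<1 1≤r

    0<r^ : ∀ m → 0# < r^ m
    0<r^ ℕ.zero  = 0<1
    0<r^ (suc m) = *-pos 0<r (0<r^ m)

    1≤r^ : ∀ m → 1# ≤ r^ m
    r≤r*r^ : ∀ m → r ≤ r * r^ m

    1≤r^ ℕ.zero  = inj₂ refl
    1≤r^ (suc m) = begin 1# ≤⟨ 1≤r ⟩ r ≤⟨ r≤r*r^ m ⟩ r * r^ m ∎

    r≤r*r^ m = begin
      r        ≈⟨ *-identityʳ r ⟨
      r * 1#   ≤⟨ *-monoˡ-≤-nonNeg (inj₁ 0<r) (1≤r^ m) ⟩
      r * r^ m ∎

    0≤w : ∀ δ → 0# ≤ w δ
    0≤w []          = inj₂ refl
    0≤w (false ∷ δ) = nonNeg+nonNeg⇒nonNeg (inj₂ (sym (zeroˡ _))) (0≤w δ)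
    0≤w (true ∷ δ)  = nonNeg+nonNeg⇒nonNeg (inj₁ (<-respʳ-≈ (sym (*-identityˡ _)) (0<r^ (length δ)))) (0≤w δ)

    -- r ≤ r^ q fails for q = 0, but then the row is empty.
    [rowWeight*y]*r≤[rowWeight*y]*r^ : ∀ q {y} → 0# ≤ y → (rowWeight q 0 * y) * r ≤ (rowWeight q 0 * y) * r^ q
    [rowWeight*y]*r≤[rowWeight*y]*r^ ℕ.zero  {y} _   = inj₂ (trans (vanish r) (sym (vanish 1#)))
      where
      vanish : ∀ x → (0# * y) * x ≈ 0#
      vanish x = trans (*-congʳ (zeroˡ y)) (zeroˡ x)
    [rowWeight*y]*r≤[rowWeight*y]*r^ (suc q) 0≤y =
      *-monoˡ-≤-nonNeg (nonNeg*nonNeg⇒nonNeg (0≤w (zerosThenOnes (suc q) 0)) 0≤y) (r≤r*r^ q)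

    Gap-zero : ∀ q → Gap (suc (suc q)) 0
    Gap-zero q = begin-strict
      r * weightC (suc (suc q)) 2 + weightC (suc (suc q)) 0
        ≈⟨ +-cong (*-congˡ (trans (weightC-suc (suc q) 1) (+-cong (*-cong (w-false-∷ (zerosThenOnes q 0)) (r^N-suc q)) (weightC-one q))))
                  (weightC-zero (suc (suc q))) ⟩
      r * (G * (a * Y) + G * Y) + 0#
        ≈⟨ solve 4 (λ ρ α γ υ → ρ :* (γ :* (α :* υ) :+ γ :* υ) :+ con 0 := ρ :* (γ :* (α :* υ)) :+ γ :* υ :* ρ)
                   refl r a G Y ⟩
      r * (G * (a * Y)) + (G * Y) * r
        <⟨ +-monoˡ-< _ (x≤y⇒x<z+y ([rowWeight*y]*r≤[rowWeight*y]*r^ q (inj₁ (0<r^ (length (edges q))))) 0<Z) ⟩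
      r * (G * (a * Y)) + (Z + (G * Y) * a)
        ≈⟨ solve 4 (λ ρ α γ υ → ρ :* (γ :* (α :* υ)) :+ ((ρ :* (α :* α) :+ α :* α) :* υ :+ γ :* υ :* α)
                              := ρ :* ((α :+ γ) :* (α :* υ)) :+ (α :+ γ) :* (α :* υ))
                   refl r a G Y ⟩
      r * ((a + G) * (a * Y)) + (a + G) * (a * Y)     ≈⟨ +-cong (*-congˡ (sym weightC-1≈)) (sym weightC-1≈) ⟩
      r * weightC (suc (suc q)) 1 + weightC (suc (suc q)) 1 ∎
      where
      a G Y Z : Carrier
      a = r^ q
      G = rowWeight q 0
      Y = r^N q
      Z = (r * (a * a) + a * a) * Y

      0<Z : 0# < Z
      0<Z = *-pos (pos+nonNeg⇒pos (*-pos 0<r 0<a*a) (inj₁ 0<a*a)) (0<r^ (length (edges q)))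
        where
        0<a*a : 0# < a * a
        0<a*a = *-pos (0<r^ q) (0<r^ q)

      weightC-1≈ : weightC (suc (suc q)) 1 ≈ (a + G) * (a * Y)
      weightC-1≈ = trans (weightC-one (suc q))
        (*-cong (trans (rowWeight-suc (suc q) 0 ℕ.z<s) (+-congˡ (w-false-∷ (zerosThenOnes q 0)))) (r^N-suc q))

    Gap-holds : ∀ n k → 2 ℕ.+ k ℕ.≤ n → Gap n k
    Gap-holds (suc (suc q)) ℕ.zero  _             = Gap-zero q
    Gap-holds (suc m)       (suc k) (ℕ.s≤s 2+k≤m) = Gap-suc m k 2+k≤m (Gap-holds m k 2+k≤m)

    0<r*P[n,1+k]-P[n,k] : ∀ n k → 2 ℕ.+ k ℕ.≤ n → 0# < r * P F n (suc k) r - P F n k r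
    0<r*P[n,1+k]-P[n,k] n k 2+k≤n =
      r*z+x<r*y+y⇒0<r*[y-z]-[x-y] r (weightC n k) (weightC n (suc k)) (weightC n (suc (suc k)))
                                  (Gap-holds n k 2+k≤n)

k≤n/2∸1⇒2+k≤n : ∀ n k → 6 ℕ.≤ n → k ℕ.≤ n / 2 ∸ 1 → 2 ℕ.+ k ℕ.≤ n
k≤n/2∸1⇒2+k≤n n k 6≤n k≤n/2∸1 = begin
  2 ℕ.+ k         ≡⟨ ≡.cong suc (ℕ.+-comm 1 k) ⟩
  suc (k ℕ.+ 1)   ≤⟨ ℕ.s≤s (ℕ.m≤o∸n⇒m+n≤o k (/-monoˡ-≤ 2 (ℕ.m+n≤o⇒n≤o 4 6≤n)) k≤n/2∸1) ⟩
  suc (n / 2)     ≤⟨ m/n<m n 2 (ℕ.s≤s (ℕ.s≤s ℕ.z≤n)) ⟩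
  n               ∎
  where
  open ℕ.≤-Reasoning
  instance
    n≢0 : ℕ.NonZero n
    n≢0 = ℕ.>-nonZero (ℕ.m+n≤o⇒n≤o 5 6≤n)

mainTheorem8 : ∀ {c ℓ₁ ℓ₂} (R : CompleteOrderedField c ℓ₁ ℓ₂) →
    let open CompleteOrderedField R in
    ∀ (n k : ℕ) → 6 ℕ.≤ n → 1 ℕ.≤ k → k ℕ.≤ n / 2 ∸ 1 →
    ∀ (r : Carrier) → 1# < r →
    0# < r * P R n (suc k) r - P R n k r
mainTheorem8 R n k 6≤n _ k≤n/2∸1 r 1<r =
  Weights.0<r*P[n,1+k]-P[n,k] R r (inj₁ 1<r) n k (k≤n/2∸1⇒2+k≤n n k 6≤n k≤n/2∸1)
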